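{- Bipartiteness is not definable in $\mathrm{FO+DP}$: there is no $\mathrm{FO+DP}$ sentence $\varphi$ over $\{E\}$ such that for every finite graph $G$, $G\models\varphi$ iff $G$ is bipartite.
   Context: Graphs are finite simple undirected graphs viewed as $\{E\}$-structures. Disjoint-paths logic $\mathrm{FO+DP}$ is first-order logic over $\{E\}\cup\{\mathrm{disjoint}\text{ - }\mathrm{paths}_k:k\ge1\}$, where $\mathrm{disjoint}\text{ - }\mathrm{paths}_k$ is $2k$-ary and $G\models\mathrm{disjoint}\text{ - }\mathrm{paths}_k[(a_1,b_1),\dots,(a_k,b_k)]$ iff $G$ contains paths $P_1,\dots,P_k$, $P_i$ connecting $a_i$ and $b_i$, which are pairwise internally vertex-disjoint (every vertex lying on two of the paths is an endpoint of both; a path may be a single vertex). -}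

module Defs where

open import Data.Nat using (ℕ; suc)
open import Data.Fin using (Fin)
open import Data.Bool using (Bool; true)
open import Data.List using (List; []; _∷_)
open import Data.List.Relation.Unary.Unique.Propositional using (Unique)
open import Data.List.Membership.Propositional using (_∈_)
open import Data.Product using (Σ; _×_; proj₁; proj₂)
open import Data.Sum using (_⊎_)
open import Data.Empty using (⊥)
open import Relation.Nullary using (¬_)
open import Relation.Binary.PropositionalEquality using (_≡_; _≢_)

record Graph : Set where
  field
    n     : ℕ
    E     : Fin n → Fin n → Bool
    sym   : ∀ u v → E u v ≡ E v u
    irrefl : ∀ u → E u u ≡ Data.Bool.false

open Graph public

Adj : (G : Graph) → Fin (n G) → Fin (n G) → Set
Adj G u v = E G u v ≡ true

Bipartite : Graph → Set
Bipartite G = Σ (Fin (n G) → Bool) λ c → ∀ u v → Adj G u v → c u ≢ c v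

IsWalk : (G : Graph) → Fin (n G) → List (Fin (n G)) → Fin (n G) → Set
IsWalk G a [] b = a ≡ b
IsWalk G a (v ∷ vs) b = Adj G a v × IsWalk G v vs b

record Path (G : Graph) (a b : Fin (n G)) : Set where
  field
    rest   : List (Fin (n G))
    walk   : IsWalk G a rest b
    unique : Unique (a ∷ rest)

verts : ∀ {G a b} → Path G a b → List (Fin (n G))
verts {a = a} p = a ∷ Path.rest p

IsEndpoint : ∀ {G} → Fin (n G) → Fin (n G) × Fin (n G) → Set
IsEndpoint v ab = (v ≡ proj₁ ab) ⊎ (v ≡ proj₂ ab)

DisjointPaths : (G : Graph) (k : ℕ) → (Fin k → Fin (n G) × Fin (n G)) → Set
DisjointPaths G k ab =
  Σ ((i : Fin k) → Path G (proj₁ (ab i)) (proj₂ (ab i))) λ P →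
    ∀ i j → i ≢ j → ∀ v → v ∈ verts (P i) → v ∈ verts (P j) →
      IsEndpoint {G} v (ab i) × IsEndpoint {G} v (ab j)

-- FO+DP formulas over {E} with m free variables (de Bruijn indices).
data Formula (m : ℕ) : Set where
  eq    : Fin m → Fin m → Formula m
  edge  : Fin m → Fin m → Formula m
  dp    : (k : ℕ) → (Fin (suc k) → Fin m × Fin m) → Formula m   -- disjoint-paths_{k+1}
  ¬'    : Formula m → Formula m
  _∧'_  : Formula m → Formula m → Formula m
  _∨'_  : Formula m → Formula m → Formula m
  _⇒'_  : Formula m → Formula m → Formula m
  ∃'    : Formula (suc m) → Formula m
  ∀'    : Formula (suc m) → Formula m

Sentence : Set
Sentence = Formula 0

extend : ∀ {m} {A : Set} → (Fin m → A) → A → Fin (suc m) → A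
extend ρ x Fin.zero = x
extend ρ x (Fin.suc i) = ρ i

Sat : (G : Graph) {m : ℕ} → Formula m → (Fin m → Fin (n G)) → Set
Sat G (eq i j) ρ = ρ i ≡ ρ j
Sat G (edge i j) ρ = Adj G (ρ i) (ρ j)
Sat G (dp k ab) ρ = DisjointPaths G (suc k) (λ t → ρ (proj₁ (ab t)) , ρ (proj₂ (ab t)))
  where open import Data.Product using (_,_)
Sat G (¬' φ) ρ = ¬ Sat G φ ρ
Sat G (φ ∧' ψ) ρ = Sat G φ ρ × Sat G ψ ρ
Sat G (φ ∨' ψ) ρ = Sat G φ ρ ⊎ Sat G ψ ρ
Sat G (φ ⇒' ψ) ρ = Sat G φ ρ → Sat G ψ ρ
Sat G (∃' φ) ρ = Σ (Fin (n G)) λ v → Sat G φ (extend ρ v)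
Sat G (∀' φ) ρ = (v : Fin (n G)) → Sat G φ (extend ρ v)

emptyEnv : {A : Set} → Fin 0 → A
emptyEnv ()

_⊨_ : Graph → Sentence → Set
G ⊨ φ = Sat G φ emptyEnv

{-# OPTIONS --safe #-}
-- Let C[n,t] be the n-cycle with every vertex blown up into t independent copies, (i,c) ~ (i ± 1,c′).
-- It is bipartite iff n is even. Once t ≥ 3k, every disjoint-paths_k atom holds in C[n,t]: the i-th path
-- can run around the cycle inside its own copy, chosen to contain none of the 2k endpoints. So an FO+DP
-- sentence of quantifier rank s cannot tell C[2h+2,t] from C[2h+3,t] when h and t are large: Duplicator
-- survives s rounds by preserving equality of copies and all cyclic displacements up to 2 ^ r between
-- chosen vertices, r the number of rounds left, as in the classical game on long cycles.
module Submission where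

open import Data.Bool using (Bool; true; not)
open import Data.Bool.Properties using (not-involutive; not-¬; ¬-not)
open import Data.Fin using (Fin; zero; suc; toℕ; fromℕ<; combine; remQuot)
open import Data.Fin.Properties using (any?; pigeonhole; toℕ<n; toℕ-fromℕ<; remQuot-combine; combine-remQuot)
import Data.Fin.Properties as Fin
open import Data.List using (List; []; _∷_; _++_; length; lookup; tabulate; applyUpTo)
open import Data.List.Properties using (length-++; length-tabulate; length-applyUpTo)
open import Data.List.Membership.Propositional using (_∈_; _∉_)
open import Data.List.Membership.Propositional.Properties using (∈-++⁺ˡ; ∈-++⁺ʳ; ∈-tabulate⁺; ∈-applyUpTo⁺)
open import Data.List.Relation.Unary.All as All using ([])
open import Data.List.Relation.Unary.AllPairs using ([]; _∷_)
open import Data.List.Relation.Unary.Any using (here; there; index)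
open import Data.List.Relation.Unary.Any.Properties using (lookup-index)
open import Data.List.Relation.Unary.Unique.Propositional using (Unique)
open import Data.Nat using (ℕ; zero; suc; pred; _+_; _*_; _^_; _⊔_; _∸_; _≤_; _<_; z≤n; s≤s; _≟_;
                            NonZero; NonTrivial; >-nonZero⁻¹; nonTrivial⇒nonZero; nonTrivial⇒n>1)
open import Data.Nat.DivMod
open import Data.Nat.Properties
open import Data.Product using (Σ; ∃; _×_; _,_; proj₁; proj₂)
open import Data.Product.Function.NonDependent.Propositional using (_×-⇔_)
open import Data.Sum using (_⊎_; inj₁; inj₂; swap)
open import Data.Sum.Function.Propositional using (_⊎-⇔_)
open import Defs hiding (sym; n)
open import Function using (_∘_; case_of_; Injective)
open import Function.Bundles using (_⇔_; mk⇔; Equivalence)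
open import Function.Related.TypeIsomorphisms using (→-cong-⇔; ¬-cong-⇔)
open import Relation.Binary.Definitions using (DecidableEquality)
open import Relation.Binary.PropositionalEquality
open import Relation.Nullary using (¬_; Dec; yes; no; does; map′; ¬?; _⊎-dec_; contradiction; decidable-stable)
open import Relation.Nullary.Decidable using (dec-true; dec-false; does-⇔)

[m%n+k]%n≡[m+k]%n : ∀ m k n .{{_ : NonZero n}} → (m % n + k) % n ≡ (m + k) % n
[m%n+k]%n≡[m+k]%n m k n = begin
  (m % n + k) % n          ≡⟨ %-distribˡ-+ (m % n) k n ⟩
  (m % n % n + k % n) % n  ≡⟨ cong (λ z → (z + k % n) % n) (m%n%n≡m%n m n) ⟩
  (m % n + k % n) % n      ≡⟨ %-distribˡ-+ m k n ⟨
  (m + k) % n              ∎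
  where open ≡-Reasoning

+-cancelʳ-% : ∀ {a b} k n .{{_ : NonZero n}} → a < n → b < n → (a + k) % n ≡ (b + k) % n → a ≡ b
+-cancelʳ-% {a} {b} k n@(suc n-1) a<n b<n same =
  trans (sym (undo a<n)) (trans (cong (λ z → (z + k * n-1) % n) same) (undo b<n))
  where
    open ≡-Reasoning
    -- adding k * (n - 1) more completes k full turns
    undo : ∀ {x} → x < n → ((x + k) % n + k * n-1) % n ≡ x
    undo {x} x<n = begin
      ((x + k) % n + k * n-1) % n ≡⟨ [m%n+k]%n≡[m+k]%n (x + k) (k * n-1) n ⟩
      (x + k + k * n-1) % n       ≡⟨ cong (_% n) (+-assoc x k (k * n-1)) ⟩
      (x + (k + k * n-1)) % n     ≡⟨ cong (λ z → (x + z) % n) (*-suc k n-1) ⟨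
      (x + k * n) % n             ≡⟨ [m+kn]%n≡m%n x k n ⟩
      x % n                       ≡⟨ m<n⇒m%n≡m x<n ⟩
      x                           ∎

covering⇒≤length : ∀ {k} (L : List (Fin k)) → (∀ y → y ∈ L) → k ≤ length L
covering⇒≤length L every = ≮⇒≥ λ |L|<k → case pigeonhole |L|<k (index ∘ every) of λ where
  (i , j , i<j , same) → Fin.<⇒≢ i<j
    (trans (lookup-index (every i)) (trans (cong (lookup L) same) (sym (lookup-index (every j)))))

fresh : ∀ {k} (L : List (Fin k)) → length L < k → ∃ λ y → y ∉ L
fresh {k} L |L|<k = decidable-stable (any? λ y → ¬? (y ∈? L)) λ none →
  <⇒≱ |L|<k (covering⇒≤length L λ y → decidable-stable (y ∈? L) (none ∘ (y ,_)))
  where open import Data.List.Membership.DecPropositional (Fin._≟_ {k}) using (_∈?_)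

freshInjection : ∀ {t} k (L : List (Fin t)) → length L + k ≤ t →
                 Σ (Fin k → Fin t) λ g → Injective _≡_ _≡_ g × (∀ i → g i ∉ L)
freshInjection zero L _ = (λ ()) , (λ { {()} }) , λ ()
freshInjection {t} (suc k) L room = g , injective , avoids
  where
    room′ : suc (length L + k) ≤ t
    room′ = subst (_≤ t) (+-suc (length L) k) room
    new : ∃ λ y → y ∉ L
    new = fresh L (≤-trans (s≤s (m≤m+n (length L) k)) room′)
    rest : Σ (Fin k → Fin t) λ g → Injective _≡_ _≡_ g × (∀ i → g i ∉ proj₁ new ∷ L)
    rest = freshInjection k (proj₁ new ∷ L) room′
    g : Fin (suc k) → Fin t
    g zero = proj₁ new
    g (suc i) = proj₁ rest i
    avoids : ∀ i → g i ∉ L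
    avoids zero = proj₂ new
    avoids (suc i) = proj₂ (proj₂ rest) i ∘ there
    injective : Injective _≡_ _≡_ g
    injective {zero} {zero} _ = refl
    injective {zero} {suc j} same = contradiction (here (sym same)) (proj₂ (proj₂ rest) j)
    injective {suc i} {zero} same = contradiction (here same) (proj₂ (proj₂ rest) i)
    injective {suc i} {suc j} same = cong suc (proj₁ (proj₂ rest) same)

module CyclicDisplacement (n : ℕ) .{{_ : NonZero n}} where

  infix 4 _⟶⟨_⟩_ _⟶⟨_⟩?_

  data _⟶⟨_⟩_ (x d y : ℕ) : Set where
    step : (x + d) % n ≡ y → x ⟶⟨ d ⟩ y

  _⟶⟨_⟩?_ : ∀ x d y → Dec (x ⟶⟨ d ⟩ y)
  x ⟶⟨ d ⟩? y = map′ step (λ { (step e) → e }) ((x + d) % n ≟ y)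

  ⟶-target : ∀ x d → x ⟶⟨ d ⟩ ((x + d) % n)
  ⟶-target x d = step refl

  ⟶-functional : ∀ {x d y z} → x ⟶⟨ d ⟩ y → x ⟶⟨ d ⟩ z → y ≡ z
  ⟶-functional (step refl) (step refl) = refl

  ⟶-refl : ∀ {x} → x < n → x ⟶⟨ 0 ⟩ x
  ⟶-refl {x} x<n = step (trans (cong (_% n) (+-identityʳ x)) (m<n⇒m%n≡m x<n))

  ⟶0⇒≡ : ∀ {x y} → x < n → x ⟶⟨ 0 ⟩ y → x ≡ y
  ⟶0⇒≡ x<n xy = ⟶-functional (⟶-refl x<n) xy

  ⟶-trans : ∀ {x y z d e} → x ⟶⟨ d ⟩ y → y ⟶⟨ e ⟩ z → x ⟶⟨ d + e ⟩ z
  ⟶-trans {x} {d = d} {e} (step refl) (step refl) = step (begin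
    (x + (d + e)) % n     ≡⟨ cong (_% n) (+-assoc x d e) ⟨
    (x + d + e) % n       ≡⟨ [m%n+k]%n≡[m+k]%n (x + d) e n ⟨
    ((x + d) % n + e) % n ∎)
    where open ≡-Reasoning

  ⟶-full-turn : ∀ {x y} → x ⟶⟨ 0 ⟩ y → x ⟶⟨ n ⟩ y
  ⟶-full-turn {x} (step e) = step (trans ([m+n]%n≡m%n x n) (trans (cong (_% n) (sym (+-identityʳ x))) e))

  ⟶-residualʳ : ∀ {x y z d e} → x ⟶⟨ d ⟩ y → x ⟶⟨ e ⟩ z → d ≤ e → y ⟶⟨ e ∸ d ⟩ z
  ⟶-residualʳ {x} {d = d} {e} (step refl) (step refl) d≤e = step (begin
    ((x + d) % n + (e ∸ d)) % n ≡⟨ [m%n+k]%n≡[m+k]%n (x + d) (e ∸ d) n ⟩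
    (x + d + (e ∸ d)) % n       ≡⟨ cong (_% n) (+-assoc x d (e ∸ d)) ⟩
    (x + (d + (e ∸ d))) % n     ≡⟨ cong (λ k → (x + k) % n) (m+[n∸m]≡n d≤e) ⟩
    (x + e) % n                 ∎)
    where open ≡-Reasoning

  ⟶-residualˡ : ∀ {x y z d e} → y < n → z < n → y ⟶⟨ d ⟩ x → z ⟶⟨ e ⟩ x → e ≤ d → y ⟶⟨ d ∸ e ⟩ z
  ⟶-residualˡ {x} {y} {z} {d} {e} y<n z<n (step yx) (step zx) e≤d =
    subst (y ⟶⟨ d ∸ e ⟩_) (+-cancelʳ-% e n (m%n<n _ n) z<n (trans wx (sym zx))) (⟶-target y (d ∸ e))
    where
      wx : ((y + (d ∸ e)) % n + e) % n ≡ x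
      wx with ⟶-trans (⟶-target y (d ∸ e)) (⟶-target _ e)
      ... | step yw = trans (sym yw) (trans (cong (λ k → (y + k) % n) (m∸n+n≡m e≤d)) yx)

  ⟶-loop⇒0 : ∀ {x e} → x < n → e < n → x ⟶⟨ e ⟩ x → e ≡ 0
  ⟶-loop⇒0 {x} {e} x<n e<n (step xx) =
    +-cancelʳ-% x n e<n (>-nonZero⁻¹ n) (trans (cong (_% n) (+-comm e x)) (trans xx (sym (m<n⇒m%n≡m x<n))))

  ⟶-source : ∀ {x d} → x < n → d ≤ n → (x + (n ∸ d)) % n ⟶⟨ d ⟩ x
  ⟶-source {x} {d} x<n d≤n = step (begin
    ((x + (n ∸ d)) % n + d) % n ≡⟨ [m%n+k]%n≡[m+k]%n (x + (n ∸ d)) d n ⟩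
    (x + (n ∸ d) + d) % n       ≡⟨ cong (_% n) (+-assoc x (n ∸ d) d) ⟩
    (x + (n ∸ d + d)) % n       ≡⟨ cong (λ k → (x + k) % n) (m∸n+n≡m d≤n) ⟩
    (x + n) % n                 ≡⟨ [m+n]%n≡m%n x n ⟩
    x % n                       ≡⟨ m<n⇒m%n≡m x<n ⟩
    x                           ∎)
    where open ≡-Reasoning

  ⟶-source-unique : ∀ {x y d} → x < n → y < n → d ≤ n → y ⟶⟨ d ⟩ x → y ≡ (x + (n ∸ d)) % n
  ⟶-source-unique {x} {y} {d} x<n y<n d≤n (step yx) with ⟶-source {x} {d} x<n d≤n
  ... | step wx = +-cancelʳ-% d n y<n (m%n<n _ n) (trans yx (sym wx))

  ⟶-positive : ∀ {x y} → x < n → y < n → ∃ λ k → k < n × x ⟶⟨ suc k ⟩ y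
  ⟶-positive {x} {y} x<n y<n = go _ (m%n<n (y + (n ∸ x)) n) x⟶y
    where
      x⟶y : x ⟶⟨ (y + (n ∸ x)) % n ⟩ y
      x⟶y with ⟶-source {y} {x} y<n (<⇒≤ x<n)
      ... | step wxy = step (trans (cong (_% n) (+-comm x _)) wxy)
      go : ∀ w → w < n → x ⟶⟨ w ⟩ y → ∃ λ k → k < n × x ⟶⟨ suc k ⟩ y
      go zero _ x⟶⁰y = pred n , ≤-reflexive (suc-pred n) , subst (x ⟶⟨_⟩ y) (sym (suc-pred n)) (⟶-full-turn x⟶⁰y)
      go (suc k) k<n x⟶ʷy = k , <-trans (n<1+n k) k<n , x⟶ʷy

  Far : ∀ {m} → ℕ → ℕ → (Fin m → ℕ) → Set
  Far c x p = ∀ i d → d ≤ c → ¬ (p i ⟶⟨ d ⟩ x) × ¬ (x ⟶⟨ d ⟩ p i)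

  data Proximity {m} (c : ℕ) (p : Fin m → ℕ) (x : ℕ) : Set where
    behind : ∀ i d → d ≤ c → p i ⟶⟨ d ⟩ x → Proximity c p x
    ahead  : ∀ i d → d ≤ c → x ⟶⟨ d ⟩ p i → Proximity c p x
    far    : Far c x p → Proximity c p x

  proximity : ∀ {m} c (p : Fin m → ℕ) x → Proximity c p x
  proximity c p x with any? (λ i → anyUpTo? (λ d → p i ⟶⟨ d ⟩? x) (suc c))
  ... | yes (i , d , d<1+c , p⟶x) = behind i d (≤-pred d<1+c) p⟶x
  ... | no ¬behind with any? (λ i → anyUpTo? (λ d → x ⟶⟨ d ⟩? p i) (suc c))
  ...   | yes (i , d , d<1+c , x⟶p) = ahead i d (≤-pred d<1+c) x⟶p
  ...   | no ¬ahead = far λ i d d≤c → (λ p⟶x → ¬behind (i , d , s≤s d≤c , p⟶x)) ,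
                                      (λ x⟶p → ¬ahead (i , d , s≤s d≤c , x⟶p))

  wrap : ℕ → Fin n
  wrap x = fromℕ< (m%n<n x n)

  toℕ-wrap : ∀ x → toℕ (wrap x) ≡ x % n
  toℕ-wrap x = toℕ-fromℕ< (m%n<n x n)

  wrap-≡ : ∀ {x y} → x % n ≡ toℕ y → wrap x ≡ y
  wrap-≡ {x} x≡y = Fin.toℕ-injective (trans (toℕ-wrap x) x≡y)

  ball : ℕ → ℕ → List (Fin n)
  ball x c = applyUpTo (λ d → wrap (x + d)) (suc c) ++ applyUpTo (λ d → wrap (x + (n ∸ d))) (suc c)

  balls : ∀ {m} → (Fin m → ℕ) → ℕ → List (Fin n)
  balls {zero} p c = []
  balls {suc m} p c = ball (p zero) c ++ balls (p ∘ suc) c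

  length-balls : ∀ {m} (p : Fin m → ℕ) c → length (balls p c) ≡ m * (suc c + suc c)
  length-balls {zero} p c = refl
  length-balls {suc m} p c = begin
    length (ball (p zero) c ++ balls (p ∘ suc) c)        ≡⟨ length-++ (ball (p zero) c) ⟩
    length (ball (p zero) c) + length (balls (p ∘ suc) c)
      ≡⟨ cong₂ _+_ (trans (length-++ (applyUpTo (λ d → wrap (p zero + d)) (suc c)))
                          (cong₂ _+_ (length-applyUpTo (λ d → wrap (p zero + d)) (suc c))
                                     (length-applyUpTo (λ d → wrap (p zero + (n ∸ d))) (suc c))))
                   (length-balls (p ∘ suc) c) ⟩
    suc c + suc c + m * (suc c + suc c)                  ∎
    where open ≡-Reasoning

  ⊆-balls : ∀ {m} (p : Fin m → ℕ) c i {y} → y ∈ ball (p i) c → y ∈ balls p c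
  ⊆-balls {suc m} p c zero y∈ball = ∈-++⁺ˡ y∈ball
  ⊆-balls {suc m} p c (suc i) y∈ball = ∈-++⁺ʳ (ball (p zero) c) (⊆-balls (p ∘ suc) c i y∈ball)

  ∈-ball-ahead : ∀ {x c d y} → d ≤ c → x ⟶⟨ d ⟩ toℕ y → y ∈ ball x c
  ∈-ball-ahead {x} {c} d≤c (step x⟶y) =
    subst (_∈ ball x c) (wrap-≡ x⟶y) (∈-++⁺ˡ (∈-applyUpTo⁺ (λ d → wrap (x + d)) (s≤s d≤c)))

  ∈-ball-behind : ∀ {x c d y} → x < n → c < n → d ≤ c → toℕ y ⟶⟨ d ⟩ x → y ∈ ball x c
  ∈-ball-behind {x} {c} {d} {y} x<n c<n d≤c y⟶x =
    subst (_∈ ball x c) (wrap-≡ (sym (⟶-source-unique x<n (toℕ<n y) (<⇒≤ (≤-<-trans d≤c c<n)) y⟶x)))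
      (∈-++⁺ʳ (applyUpTo (λ d → wrap (x + d)) (suc c)) (∈-applyUpTo⁺ (λ d → wrap (x + (n ∸ d))) (s≤s d≤c)))

  far-exists : ∀ {m} c (p : Fin m → ℕ) → (∀ i → p i < n) → c < n → m * (suc c + suc c) < n →
               ∃ λ (y : Fin n) → Far c (toℕ y) p
  far-exists c p p<n c<n room with fresh (balls p c) (subst (_< n) (sym (length-balls p c)) room)
  ... | y , y∉balls = y , λ i d d≤c →
    y∉balls ∘ ⊆-balls p c i ∘ ∈-ball-ahead d≤c , y∉balls ∘ ⊆-balls p c i ∘ ∈-ball-behind (p<n i) c<n d≤c

module PartialIsomorphism (a b : ℕ) .{{_ : NonZero a}} .{{_ : NonZero b}} where
  module A = CyclicDisplacement a
  module B = CyclicDisplacement b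

  infix 4 _≼⟨_⟩_

  _≼⟨_⟩_ : ∀ {m} → (Fin m → ℕ) → ℕ → (Fin m → ℕ) → Set
  p ≼⟨ c ⟩ q = ∀ i j d → d ≤ c → p i A.⟶⟨ d ⟩ p j → q i B.⟶⟨ d ⟩ q j

  private
    ≤-double : ∀ {c d} → d ≤ c → d ≤ 2 * c
    ≤-double {c} d≤c = ≤-trans d≤c (m≤m+n c _)

    +-≤-double : ∀ {c d e} → d ≤ c → e ≤ c → d + e ≤ 2 * c
    +-≤-double {c} d≤c e≤c = +-mono-≤ d≤c (≤-trans e≤c (m≤m+n c 0))

  -- p zero is the new point: a displacement of at most c between it and an old point composes with
  -- the anchoring displacement (also at most c) to one of at most 2 c between old points, which old transfers.
  module _ {m c} {p q : Fin (suc m) → ℕ} (p<a : ∀ i → p i < a) (q<b : ∀ i → q i < b) (c<a : c < a)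
           (old : p ∘ suc ≼⟨ 2 * c ⟩ q ∘ suc) where

    private
      loop : ∀ e → e ≤ c → p zero A.⟶⟨ e ⟩ p zero → q zero B.⟶⟨ e ⟩ q zero
      loop e e≤c pp with A.⟶-loop⇒0 (p<a zero) (≤-<-trans e≤c c<a) pp
      ... | refl = B.⟶-refl (q<b zero)

    extend-behind : ∀ i d → d ≤ c → p (suc i) A.⟶⟨ d ⟩ p zero → q (suc i) B.⟶⟨ d ⟩ q zero → p ≼⟨ c ⟩ q
    extend-behind i d d≤c pi₀ qi₀ zero zero e e≤c pp = loop e e≤c pp
    extend-behind i d d≤c pi₀ qi₀ (suc j) zero e e≤c pj₀ with ≤-total e d
    ... | inj₁ e≤d =
      let qij = old i j (d ∸ e) (≤-double (≤-trans (m∸n≤m d e) d≤c))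
                    (A.⟶-residualˡ (p<a (suc i)) (p<a (suc j)) pi₀ pj₀ e≤d)
      in subst (q (suc j) B.⟶⟨_⟩ q zero) (m∸[m∸n]≡n e≤d) (B.⟶-residualʳ qij qi₀ (m∸n≤m d e))
    ... | inj₂ d≤e =
      let qji = old j i (e ∸ d) (≤-double (≤-trans (m∸n≤m e d) e≤c))
                    (A.⟶-residualˡ (p<a (suc j)) (p<a (suc i)) pj₀ pi₀ d≤e)
      in subst (q (suc j) B.⟶⟨_⟩ q zero) (m∸n+n≡m d≤e) (B.⟶-trans qji qi₀)
    extend-behind i d d≤c pi₀ qi₀ zero (suc j) e e≤c p₀j =
      let qij = old i j (d + e) (+-≤-double d≤c e≤c) (A.⟶-trans pi₀ p₀j)
      in subst (q zero B.⟶⟨_⟩ q (suc j)) (m+n∸m≡n d e) (B.⟶-residualʳ qi₀ qij (m≤m+n d e))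
    extend-behind i d d≤c pi₀ qi₀ (suc j) (suc k) e e≤c pjk = old j k e (≤-double e≤c) pjk

    extend-ahead : ∀ i d → d ≤ c → p zero A.⟶⟨ d ⟩ p (suc i) → q zero B.⟶⟨ d ⟩ q (suc i) → p ≼⟨ c ⟩ q
    extend-ahead i d d≤c p₀i q₀i zero zero e e≤c pp = loop e e≤c pp
    extend-ahead i d d≤c p₀i q₀i (suc j) zero e e≤c pj₀ =
      let qji = old j i (e + d) (+-≤-double e≤c d≤c) (A.⟶-trans pj₀ p₀i)
      in subst (q (suc j) B.⟶⟨_⟩ q zero) (m+n∸n≡m e d) (B.⟶-residualˡ (q<b (suc j)) (q<b zero) qji q₀i (m≤n+m d e))
    extend-ahead i d d≤c p₀i q₀i zero (suc j) e e≤c p₀j with ≤-total d e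
    ... | inj₁ d≤e =
      let qij = old i j (e ∸ d) (≤-double (≤-trans (m∸n≤m e d) e≤c)) (A.⟶-residualʳ p₀i p₀j d≤e)
      in subst (q zero B.⟶⟨_⟩ q (suc j)) (m+[n∸m]≡n d≤e) (B.⟶-trans q₀i qij)
    ... | inj₂ e≤d =
      let qji = old j i (d ∸ e) (≤-double (≤-trans (m∸n≤m d e) d≤c)) (A.⟶-residualʳ p₀j p₀i e≤d)
      in subst (q zero B.⟶⟨_⟩ q (suc j)) (m∸[m∸n]≡n e≤d)
               (B.⟶-residualˡ (q<b zero) (q<b (suc j)) q₀i qji (m∸n≤m d e))
    extend-ahead i d d≤c p₀i q₀i (suc j) (suc k) e e≤c pjk = old j k e (≤-double e≤c) pjk

    extend-far : A.Far c (p zero) (p ∘ suc) → p ≼⟨ c ⟩ q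
    extend-far far zero zero e e≤c pp = loop e e≤c pp
    extend-far far (suc j) zero e e≤c pj₀ = contradiction pj₀ (proj₁ (far j e e≤c))
    extend-far far zero (suc j) e e≤c p₀j = contradiction p₀j (proj₂ (far j e e≤c))
    extend-far far (suc j) (suc k) e e≤c pjk = old j k e (≤-double e≤c) pjk

infix 4 _ker⊆_

_ker⊆_ : ∀ {m} {A B : Set} → (Fin m → A) → (Fin m → B) → Set
p ker⊆ q = ∀ i j → p i ≡ p j → q i ≡ q j

data CopyMatch {m} {A B : Set} (p : Fin m → A) (x : A) (q : Fin m → B) (y : B) : Set where
  matched   : ∀ i → p i ≡ x → q i ≡ y → CopyMatch p x q y
  unmatched : (∀ i → p i ≢ x) → (∀ i → q i ≢ y) → CopyMatch p x q y

CopyMatch-sym : ∀ {m} {A B : Set} {p : Fin m → A} {x q} {y : B} → CopyMatch p x q y → CopyMatch q y p x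
CopyMatch-sym (matched i pi≡x qi≡y) = matched i qi≡y pi≡x
CopyMatch-sym (unmatched p≢x q≢y) = unmatched q≢y p≢x

matchCopy : ∀ {m t} {A : Set} → DecidableEquality A → (p : Fin m → A) (x : A) (q : Fin m → Fin t) → m < t →
            ∃ λ y → CopyMatch p x q y
matchCopy {t = t} _≟_ p x q m<t with any? (λ i → p i ≟ x)
... | yes (i , pi≡x) = q i , matched i pi≡x refl
... | no none with fresh (tabulate q) (subst (_< t) (sym (length-tabulate q)) m<t)
...   | y , y∉q = y , unmatched (λ i pi≡x → none (i , pi≡x))
                        (λ i qi≡y → y∉q (subst (_∈ tabulate q) qi≡y (∈-tabulate⁺ i)))

ker⊆-extend : ∀ {m} {A B : Set} {p : Fin (suc m) → A} {q : Fin (suc m) → B} →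
              CopyMatch (p ∘ suc) (p zero) (q ∘ suc) (q zero) → p ∘ suc ker⊆ q ∘ suc → p ker⊆ q
ker⊆-extend _ old zero zero _ = refl
ker⊆-extend (matched i pi≡p₀ qi≡q₀) old zero (suc j) p₀≡pj = trans (sym qi≡q₀) (old i j (trans pi≡p₀ p₀≡pj))
ker⊆-extend (matched i pi≡p₀ qi≡q₀) old (suc j) zero pj≡p₀ = trans (old j i (trans pj≡p₀ (sym pi≡p₀))) qi≡q₀
ker⊆-extend (unmatched p≢p₀ _) old zero (suc j) p₀≡pj = contradiction (sym p₀≡pj) (p≢p₀ j)
ker⊆-extend (unmatched p≢p₀ _) old (suc j) zero pj≡p₀ = contradiction pj≡p₀ (p≢p₀ j)
ker⊆-extend _ old (suc j) (suc k) pj≡pk = old j k pj≡pk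

module Blowup (n t : ℕ) .{{_ : NonTrivial n}} where

  instance
    n-nonZero : NonZero n
    n-nonZero = nonTrivial⇒nonZero n

  open CyclicDisplacement n public

  Vertex : Set
  Vertex = Fin (n * t)

  vertex : Fin n → Fin t → Vertex
  vertex = combine

  position : Vertex → Fin n
  position v = proj₁ (remQuot {n} t v)

  copy : Vertex → Fin t
  copy v = proj₂ (remQuot {n} t v)

  pos : Vertex → ℕ
  pos = toℕ ∘ position

  pos<n : ∀ v → pos v < n
  pos<n v = toℕ<n (position v)

  position-vertex : ∀ p c → position (vertex p c) ≡ p
  position-vertex p c = cong proj₁ (remQuot-combine p c)

  pos-vertex : ∀ p c → pos (vertex p c) ≡ toℕ p
  pos-vertex p c = cong toℕ (position-vertex p c)

  copy-vertex : ∀ p c → copy (vertex p c) ≡ c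
  copy-vertex p c = cong proj₂ (remQuot-combine p c)

  vertex-≡ : ∀ {u v} → position u ≡ position v → copy u ≡ copy v → u ≡ v
  vertex-≡ {u} {v} pu≡pv cu≡cv =
    trans (sym (combine-remQuot {n} t u)) (trans (cong₂ combine pu≡pv cu≡cv) (combine-remQuot {n} t v))

  Adjacent : Vertex → Vertex → Set
  Adjacent u v = pos u ⟶⟨ 1 ⟩ pos v ⊎ pos v ⟶⟨ 1 ⟩ pos u

  adjacent? : ∀ u v → Dec (Adjacent u v)
  adjacent? u v = (pos u ⟶⟨ 1 ⟩? pos v) ⊎-dec (pos v ⟶⟨ 1 ⟩? pos u)

  ¬Adjacent-refl : ∀ v → ¬ Adjacent v v
  ¬Adjacent-refl v adj = contradiction (⟶-loop⇒0 (pos<n v) (nonTrivial⇒n>1 n) (reduce adj)) λ ()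
    where
      reduce : Adjacent v v → pos v ⟶⟨ 1 ⟩ pos v
      reduce (inj₁ vv) = vv
      reduce (inj₂ vv) = vv

  graph : Graph
  graph = record
    { n      = n * t
    ; E      = λ u v → does (adjacent? u v)
    ; sym    = λ u v → does-⇔ (mk⇔ swap swap) (adjacent? u v) (adjacent? v u)
    ; irrefl = λ v → dec-false (adjacent? v v) (¬Adjacent-refl v)
    }

  Adjacent⇒Adj : ∀ {u v} → Adjacent u v → Adj graph u v
  Adjacent⇒Adj {u} {v} = dec-true (adjacent? u v)

  Adj⇒Adjacent : ∀ {u v} → Adj graph u v → Adjacent u v
  Adj⇒Adjacent {u} {v} = witness (adjacent? u v)
    where
      witness : ∀ {A : Set} (a? : Dec A) → does a? ≡ true → A
      witness (yes a) _ = a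
      witness (no _) ()

  next : Fin n → Fin n
  next p = wrap (toℕ p + 1)

  ⟶-next : ∀ p c → toℕ p ⟶⟨ 1 ⟩ pos (vertex (next p) c)
  ⟶-next p c = subst (toℕ p ⟶⟨ 1 ⟩_) (sym (trans (pos-vertex (next p) c) (toℕ-wrap _))) (⟶-target (toℕ p) 1)

  module _ (b : Vertex) (c : Fin t) where

    route : Fin n → ℕ → List Vertex
    route p zero = b ∷ []
    route p (suc k) = vertex (next p) c ∷ route (next p) k

    route-walk : ∀ k p {u} → position u ≡ p → toℕ p ⟶⟨ suc k ⟩ pos b → IsWalk graph u (route p k) b
    route-walk zero p refl p⟶b = Adjacent⇒Adj (inj₁ p⟶b) , refl
    route-walk (suc k) p refl p⟶b =
      Adjacent⇒Adj (inj₁ (⟶-next p c)) ,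
      route-walk k (next p) (position-vertex (next p) c)
        (subst (_⟶⟨ suc k ⟩ pos b) (pos-vertex (next p) c) (⟶-residualʳ (⟶-next p c) p⟶b (s≤s z≤n)))

    route-member : ∀ k p {v} → v ∈ route p k →
                   v ≡ b ⊎ (copy v ≡ c × ∃ λ j → j < k × toℕ p ⟶⟨ suc j ⟩ pos v)
    route-member zero p (here v≡b) = inj₁ v≡b
    route-member (suc k) p (here refl) = inj₂ (copy-vertex (next p) c , 0 , s≤s z≤n , ⟶-next p c)
    route-member (suc k) p (there v∈route) with route-member k (next p) v∈route
    ... | inj₁ v≡b = inj₁ v≡b
    ... | inj₂ (v-in-c , j , j<k , next⟶v) =
      inj₂ (v-in-c , suc j , s≤s j<k ,
            ⟶-trans (⟶-next p c) (subst (_⟶⟨ suc j ⟩ _) (sym (pos-vertex (next p) c)) next⟶v))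

    route-unique : copy b ≢ c → ∀ k p → k < n → Unique (route p k)
    route-unique b∉c zero p _ = [] ∷ []
    route-unique b∉c (suc k) p k<n = All.tabulate head-fresh ∷ route-unique b∉c k (next p) (<-trans (n<1+n k) k<n)
      where
        head-fresh : ∀ {v} → v ∈ route (next p) k → vertex (next p) c ≢ v
        head-fresh {v} v∈route refl with route-member k (next p) v∈route
        ... | inj₁ v≡b = b∉c (trans (cong copy (sym v≡b)) (copy-vertex (next p) c))
        ... | inj₂ (_ , j , j<k , v⟶v) =
          contradiction (⟶-loop⇒0 (pos<n v) (≤-trans (s≤s j<k) (<⇒≤ k<n))
                                  (subst (_⟶⟨ suc j ⟩ pos v) (sym (pos-vertex (next p) c)) v⟶v)) λ ()

  InnerVerticesIn : Fin t → ∀ {a b} → Path graph a b → Set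
  InnerVerticesIn c {a} {b} P = ∀ v → v ∈ verts P → v ≡ a ⊎ v ≡ b ⊎ copy v ≡ c

  pathVia : ∀ a b c → copy a ≢ c → copy b ≢ c → Σ (Path graph a b) (InnerVerticesIn c)
  pathVia a b c a∉c b∉c with a Fin.≟ b
  ... | yes refl = record { rest = [] ; walk = refl ; unique = [] ∷ [] } , λ { v (here v≡a) → inj₁ v≡a }
  ... | no a≢b with ⟶-positive (pos<n a) (pos<n b)
  ...   | k , k<n , a⟶b = P , inner
    where
      a-fresh : ∀ {v} → v ∈ route b c (position a) k → a ≢ v
      a-fresh v∈route refl with route-member b c k (position a) v∈route
      ... | inj₁ a≡b = a≢b a≡b
      ... | inj₂ (a-in-c , _) = a∉c a-in-c
      P : Path graph a b
      P = record { rest   = route b c (position a) k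
                 ; walk   = route-walk b c k (position a) refl a⟶b
                 ; unique = All.tabulate a-fresh ∷ route-unique b c b∉c k (position a) k<n }
      inner : InnerVerticesIn c P
      inner v (here v≡a) = inj₁ v≡a
      inner v (there v∈route) with route-member b c k (position a) v∈route
      ... | inj₁ v≡b = inj₂ (inj₁ v≡b)
      ... | inj₂ (v-in-c , _) = inj₂ (inj₂ v-in-c)

  disjointPaths : ∀ k (ab : Fin k → Vertex × Vertex) → 3 * k ≤ t → DisjointPaths graph k ab
  disjointPaths k ab room = proj₁ ∘ path , disjoint
    where
      endpointCopies : List (Fin t)
      endpointCopies = tabulate (copy ∘ proj₁ ∘ ab) ++ tabulate (copy ∘ proj₂ ∘ ab)
      room′ : length endpointCopies + k ≤ t
      room′ = subst (_≤ t) (sym (begin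
        length endpointCopies + k ≡⟨ cong (_+ k) (length-++ (tabulate (copy ∘ proj₁ ∘ ab))) ⟩
        length (tabulate (copy ∘ proj₁ ∘ ab)) + length (tabulate (copy ∘ proj₂ ∘ ab)) + k
          ≡⟨ cong₂ (λ x y → x + y + k) (length-tabulate (copy ∘ proj₁ ∘ ab))
                                        (length-tabulate (copy ∘ proj₂ ∘ ab)) ⟩
        k + k + k                 ≡⟨ +-assoc k k k ⟩
        k + (k + k)               ≡⟨ cong (λ x → k + (k + x)) (+-identityʳ k) ⟨
        3 * k                     ∎)) room
        where open ≡-Reasoning
      injection : Σ (Fin k → Fin t) λ g → Injective _≡_ _≡_ g × (∀ i → g i ∉ endpointCopies)
      injection = freshInjection k endpointCopies room′
      g : Fin k → Fin t
      g = proj₁ injection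
      source∉ : ∀ i j → copy (proj₁ (ab j)) ≢ g i
      source∉ i j same = proj₂ (proj₂ injection) i (subst (_∈ endpointCopies) same (∈-++⁺ˡ (∈-tabulate⁺ j)))
      target∉ : ∀ i j → copy (proj₂ (ab j)) ≢ g i
      target∉ i j same =
        proj₂ (proj₂ injection) i
          (subst (_∈ endpointCopies) same (∈-++⁺ʳ (tabulate (copy ∘ proj₁ ∘ ab)) (∈-tabulate⁺ j)))
      path : ∀ i → Σ (Path graph (proj₁ (ab i)) (proj₂ (ab i))) (InnerVerticesIn (g i))
      path i = pathVia (proj₁ (ab i)) (proj₂ (ab i)) (g i) (source∉ i i) (target∉ i i)
      outside : ∀ i j → i ≢ j → ∀ v → v ∈ verts (proj₁ (path j)) → copy v ≢ g i
      outside i j i≢j v v∈Pj v-in-gi with proj₂ (path j) v v∈Pj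
      ... | inj₁ refl = source∉ i j v-in-gi
      ... | inj₂ (inj₁ refl) = target∉ i j v-in-gi
      ... | inj₂ (inj₂ v-in-gj) = i≢j (proj₁ (proj₂ injection) (trans (sym v-in-gi) v-in-gj))
      endpoint : ∀ i v → copy v ≢ g i → v ∈ verts (proj₁ (path i)) → IsEndpoint {graph} v (ab i)
      endpoint i v v∉gi v∈Pi with proj₂ (path i) v v∈Pi
      ... | inj₁ v≡a = inj₁ v≡a
      ... | inj₂ (inj₁ v≡b) = inj₂ v≡b
      ... | inj₂ (inj₂ v-in-gi) = contradiction v-in-gi v∉gi
      disjoint : ∀ i j → i ≢ j → ∀ v → v ∈ verts (proj₁ (path i)) → v ∈ verts (proj₁ (path j)) →
                 IsEndpoint {graph} v (ab i) × IsEndpoint {graph} v (ab j)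
      disjoint i j i≢j v v∈Pi v∈Pj =
        endpoint i v (outside i j i≢j v v∈Pj) v∈Pi , endpoint j v (outside j i (i≢j ∘ sym) v v∈Pi) v∈Pj

alternate : ℕ → Bool → Bool
alternate zero b = b
alternate (suc k) b = not (alternate k b)

alternate-+-self : ∀ k b → alternate (k + k) b ≡ b
alternate-+-self zero b = refl
alternate-+-self (suc k) b = begin
  not (alternate (k + suc k) b)     ≡⟨ cong (λ j → not (alternate j b)) (+-suc k k) ⟩
  not (not (alternate (k + k) b))   ≡⟨ not-involutive (alternate (k + k) b) ⟩
  alternate (k + k) b               ≡⟨ alternate-+-self k b ⟩
  b                                 ∎
  where open ≡-Reasoning

module _ (h t : ℕ) where
  private
    N : ℕ
    N = 2 + (h + h)
  open Blowup N t

  ⟶1-alternates : ∀ {x y} b → x < N → x ⟶⟨ 1 ⟩ y → alternate y b ≡ not (alternate x b)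
  ⟶1-alternates {x} b x<N (step refl) with m≤n⇒m<n∨m≡n x<N
  ... | inj₁ 1+x<N = cong (λ z → alternate z b) (trans (cong (_% N) (+-comm x 1)) (m<n⇒m%n≡m 1+x<N))
  ... | inj₂ refl = begin
    alternate ((suc (h + h) + 1) % N) b ≡⟨ cong (λ z → alternate (z % N) b) (+-comm (suc (h + h)) 1) ⟩
    alternate (N % N) b                 ≡⟨ cong (λ z → alternate z b) (n%n≡0 N) ⟩
    b                                   ≡⟨ alternate-+-self h b ⟨
    alternate (h + h) b                 ≡⟨ not-involutive (alternate (h + h) b) ⟨
    not (alternate (suc (h + h)) b)     ∎
    where open ≡-Reasoning

  even-blowup-bipartite : Bipartite graph
  even-blowup-bipartite = colour , proper
    where
      colour : Vertex → Bool
      colour v = alternate (pos v) true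
      proper : ∀ u v → Adj graph u v → colour u ≢ colour v
      proper u v uv with Adj⇒Adjacent uv
      ... | inj₁ u⟶v = λ same → not-¬ refl (trans same (⟶1-alternates true (pos<n u) u⟶v))
      ... | inj₂ v⟶u = λ same → not-¬ refl (trans (sym same) (⟶1-alternates true (pos<n v) v⟶u))

module _ (h t : ℕ) where
  private
    N : ℕ
    N = 3 + (h + h)
  open Blowup N (suc t)

  odd-blowup-not-bipartite : ¬ Bipartite graph
  odd-blowup-not-bipartite (colour , proper) =
    proper (w last) (w 0) (adjacent last 0 (trans (w⟶w last) (trans (n%n≡0 N) (sym (pos-w 0))))) (begin
      colour (w last)                  ≡⟨ forced last ⟩
      alternate last (colour (w 0))    ≡⟨ not-involutive (alternate (h + h) (colour (w 0))) ⟩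
      alternate (h + h) (colour (w 0)) ≡⟨ alternate-+-self h (colour (w 0)) ⟩
      colour (w 0)                     ∎)
    where
      open ≡-Reasoning
      last : ℕ
      last = 2 + (h + h)
      w : ℕ → Vertex
      w j = vertex (wrap j) zero
      pos-w : ∀ j → pos (w j) ≡ j % N
      pos-w j = trans (pos-vertex (wrap j) zero) (toℕ-wrap j)
      w⟶w : ∀ j → (pos (w j) + 1) % N ≡ suc j % N
      w⟶w j = begin
        (pos (w j) + 1) % N ≡⟨ cong (λ x → (x + 1) % N) (pos-w j) ⟩
        (j % N + 1) % N     ≡⟨ [m%n+k]%n≡[m+k]%n j 1 N ⟩
        (j + 1) % N         ≡⟨ cong (_% N) (+-comm j 1) ⟩
        suc j % N           ∎
      adjacent : ∀ i j → (pos (w i) + 1) % N ≡ pos (w j) → Adj graph (w i) (w j)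
      adjacent i j i⟶j = Adjacent⇒Adj {w i} {w j} (inj₁ (step i⟶j))
      forced : ∀ j → colour (w j) ≡ alternate j (colour (w 0))
      forced zero = refl
      forced (suc j) = begin
        colour (w (suc j))               ≡⟨ ¬-not (proper (w j) (w (suc j)) (adjacent j (suc j) j⟶1+j) ∘ sym) ⟩
        not (colour (w j))               ≡⟨ cong not (forced j) ⟩
        alternate (suc j) (colour (w 0)) ∎
        where
          j⟶1+j : (pos (w j) + 1) % N ≡ pos (w (suc j))
          j⟶1+j = trans (w⟶w j) (sym (pos-w (suc j)))

module Similarity (nX nY t : ℕ) .{{_ : NonTrivial nX}} .{{_ : NonTrivial nY}} where
  module X = Blowup nX t
  module Y = Blowup nY t
  module X⇒Y = PartialIsomorphism nX nY
  module Y⇒X = PartialIsomorphism nY nX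

  record Similar {m} (c : ℕ) (ρ : Fin m → X.Vertex) (σ : Fin m → Y.Vertex) : Set where
    field
      positions⇒ : X.pos ∘ ρ X⇒Y.≼⟨ c ⟩ Y.pos ∘ σ
      positions⇐ : Y.pos ∘ σ Y⇒X.≼⟨ c ⟩ X.pos ∘ ρ
      copies⇒    : X.copy ∘ ρ ker⊆ Y.copy ∘ σ
      copies⇐    : Y.copy ∘ σ ker⊆ X.copy ∘ ρ

  data PositionMatch {m} (c : ℕ) (p : Fin m → ℕ) (x : ℕ) (q : Fin m → ℕ) (y : ℕ) : Set where
    behind : ∀ i d → d ≤ c → p i X.⟶⟨ d ⟩ x → q i Y.⟶⟨ d ⟩ y → PositionMatch c p x q y
    ahead  : ∀ i d → d ≤ c → x X.⟶⟨ d ⟩ p i → y Y.⟶⟨ d ⟩ q i → PositionMatch c p x q y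
    far    : X.Far c x p → Y.Far c y q → PositionMatch c p x q y

  matchPosition : ∀ {m} c (p : Fin m → ℕ) x (q : Fin m → ℕ) → (∀ i → q i < nY) → c < nY →
                  m * (suc c + suc c) < nY → ∃ λ (y : Fin nY) → PositionMatch c p x q (toℕ y)
  matchPosition c p x q q<n c<n room with X.proximity c p x
  ... | X.behind i d d≤c p⟶x = Y.wrap (q i + d) , behind i d d≤c p⟶x (Y.step (sym (Y.toℕ-wrap _)))
  ... | X.ahead i d d≤c x⟶p =
    Y.wrap (q i + (nY ∸ d)) , ahead i d d≤c x⟶p
      (subst (Y._⟶⟨ d ⟩ q i) (sym (Y.toℕ-wrap _)) (Y.⟶-source (q<n i) (<⇒≤ (≤-<-trans d≤c c<n))))
  ... | X.far farX with Y.far-exists c q q<n c<n room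
  ...   | y , farY = y , far farX farY

  module _ {m c} {ρ : Fin m → X.Vertex} {σ : Fin m → Y.Vertex} {x : X.Vertex} {y : Y.Vertex}
           (c<nX : c < nX) (c<nY : c < nY) (old : Similar (2 * c) ρ σ) where
    open Similar old

    extend-similar : PositionMatch c (X.pos ∘ ρ) (X.pos x) (Y.pos ∘ σ) (Y.pos y) →
                     CopyMatch (X.copy ∘ ρ) (X.copy x) (Y.copy ∘ σ) (Y.copy y) →
                     Similar c (extend ρ x) (extend σ y)
    extend-similar positionMatch copyMatch = record
      { positions⇒ = positions-extend⇒ positionMatch
      ; positions⇐ = positions-extend⇐ positionMatch
      ; copies⇒    = ker⊆-extend copyMatch copies⇒
      ; copies⇐    = ker⊆-extend (CopyMatch-sym copyMatch) copies⇐
      }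
      where
        p<nX : ∀ i → X.pos (extend ρ x i) < nX
        p<nX = X.pos<n ∘ extend ρ x
        q<nY : ∀ i → Y.pos (extend σ y i) < nY
        q<nY = Y.pos<n ∘ extend σ y
        positions-extend⇒ : PositionMatch c (X.pos ∘ ρ) (X.pos x) (Y.pos ∘ σ) (Y.pos y) →
                            X.pos ∘ extend ρ x X⇒Y.≼⟨ c ⟩ Y.pos ∘ extend σ y
        positions-extend⇒ (behind i d d≤c p⟶x q⟶y) = X⇒Y.extend-behind p<nX q<nY c<nX positions⇒ i d d≤c p⟶x q⟶y
        positions-extend⇒ (ahead i d d≤c x⟶p y⟶q) = X⇒Y.extend-ahead p<nX q<nY c<nX positions⇒ i d d≤c x⟶p y⟶q
        positions-extend⇒ (far farX _) = X⇒Y.extend-far p<nX q<nY c<nX positions⇒ farX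
        positions-extend⇐ : PositionMatch c (X.pos ∘ ρ) (X.pos x) (Y.pos ∘ σ) (Y.pos y) →
                            Y.pos ∘ extend σ y Y⇒X.≼⟨ c ⟩ X.pos ∘ extend ρ x
        positions-extend⇐ (behind i d d≤c p⟶x q⟶y) = Y⇒X.extend-behind q<nY p<nX c<nY positions⇐ i d d≤c q⟶y p⟶x
        positions-extend⇐ (ahead i d d≤c x⟶p y⟶q) = Y⇒X.extend-ahead q<nY p<nX c<nY positions⇐ i d d≤c y⟶q x⟶p
        positions-extend⇐ (far _ farY) = Y⇒X.extend-far q<nY p<nX c<nY positions⇐ farY

  forth : ∀ {m c} {ρ : Fin m → X.Vertex} {σ : Fin m → Y.Vertex} → c < nX → c < nY →
          m * (suc c + suc c) < nY → m < t → Similar (2 * c) ρ σ →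
          ∀ x → ∃ λ y → Similar c (extend ρ x) (extend σ y)
  forth {m} {c} {ρ} {σ} c<nX c<nY room m<t old x
    with matchPosition c (X.pos ∘ ρ) (X.pos x) (Y.pos ∘ σ) (Y.pos<n ∘ σ) c<nY room
       | matchCopy Fin._≟_ (X.copy ∘ ρ) (X.copy x) (Y.copy ∘ σ) m<t
  ... | p , positionMatch | k , copyMatch =
    Y.vertex p k , extend-similar c<nX c<nY old
      (subst (PositionMatch c (X.pos ∘ ρ) (X.pos x) (Y.pos ∘ σ)) (sym (Y.pos-vertex p k)) positionMatch)
      (subst (CopyMatch (X.copy ∘ ρ) (X.copy x) (Y.copy ∘ σ)) (sym (Y.copy-vertex p k)) copyMatch)

  similar-≡ : ∀ {m c} {ρ : Fin m → X.Vertex} {σ : Fin m → Y.Vertex} → Similar c ρ σ →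
              ∀ i j → ρ i ≡ ρ j → σ i ≡ σ j
  similar-≡ {ρ = ρ} {σ} sim i j ρi≡ρj =
    Y.vertex-≡ (Fin.toℕ-injective (Y.⟶0⇒≡ (Y.pos<n (σ i)) (positions⇒ i j 0 z≤n ρi⟶ρj)))
               (copies⇒ i j (cong X.copy ρi≡ρj))
    where
      open Similar sim
      ρi⟶ρj : X.pos (ρ i) X.⟶⟨ 0 ⟩ X.pos (ρ j)
      ρi⟶ρj = subst (λ v → X.pos (ρ i) X.⟶⟨ 0 ⟩ X.pos v) ρi≡ρj (X.⟶-refl (X.pos<n (ρ i)))

  similar-Adj : ∀ {m c} {ρ : Fin m → X.Vertex} {σ : Fin m → Y.Vertex} → 1 ≤ c → Similar c ρ σ →
                ∀ i j → Adj X.graph (ρ i) (ρ j) → Adj Y.graph (σ i) (σ j)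
  similar-Adj {ρ = ρ} {σ} 1≤c sim i j adj with X.Adj⇒Adjacent {ρ i} {ρ j} adj
  ... | inj₁ ρi⟶ρj = Y.Adjacent⇒Adj {σ i} {σ j} (inj₁ (Similar.positions⇒ sim i j 1 1≤c ρi⟶ρj))
  ... | inj₂ ρj⟶ρi = Y.Adjacent⇒Adj {σ i} {σ j} (inj₂ (Similar.positions⇒ sim j i 1 1≤c ρj⟶ρi))

  similar-empty : ∀ {c} → Similar c emptyEnv emptyEnv
  similar-empty = record { positions⇒ = λ () ; positions⇐ = λ () ; copies⇒ = λ () ; copies⇐ = λ () }

Similar-swap : ∀ {nX nY t} .{{_ : NonTrivial nX}} .{{_ : NonTrivial nY}} {m c ρ σ} →
               Similarity.Similar nX nY t {m} c ρ σ → Similarity.Similar nY nX t c σ ρ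
Similar-swap sim = record
  { positions⇒ = positions⇐ ; positions⇐ = positions⇒ ; copies⇒ = copies⇐ ; copies⇐ = copies⇒ }
  where open Similarity.Similar sim

module _ {A B : Set} (R : A → B → Set) (zig : ∀ a → ∃ (R a)) (zag : ∀ b → ∃ λ a → R a b)
         {P : A → Set} {Q : B → Set} (P⇔Q : ∀ {a b} → R a b → P a ⇔ Q b) where

  ∃-⇔-zigzag : ∃ P ⇔ ∃ Q
  ∃-⇔-zigzag = mk⇔
    (λ (a , Pa) → proj₁ (zig a) , Equivalence.to (P⇔Q (proj₂ (zig a))) Pa)
    (λ (b , Qb) → proj₁ (zag b) , Equivalence.from (P⇔Q (proj₂ (zag b))) Qb)

  ∀-⇔-zigzag : (∀ a → P a) ⇔ (∀ b → Q b)
  ∀-⇔-zigzag = mk⇔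
    (λ ∀P b → Equivalence.to (P⇔Q (proj₂ (zag b))) (∀P (proj₁ (zag b))))
    (λ ∀Q a → Equivalence.from (P⇔Q (proj₂ (zig a))) (∀Q (proj₁ (zig a))))

rank : ∀ {m} → Formula m → ℕ
rank (eq _ _) = 0
rank (edge _ _) = 0
rank (dp _ _) = 0
rank (¬' φ) = rank φ
rank (φ ∧' ψ) = rank φ ⊔ rank ψ
rank (φ ∨' ψ) = rank φ ⊔ rank ψ
rank (φ ⇒' ψ) = rank φ ⊔ rank ψ
rank (∃' φ) = suc (rank φ)
rank (∀' φ) = suc (rank φ)

width : ∀ {m} → Formula m → ℕ
width (eq _ _) = 0
width (edge _ _) = 0
width (dp k _) = k
width (¬' φ) = width φ
width (φ ∧' ψ) = width φ ⊔ width ψ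
width (φ ∨' ψ) = width φ ⊔ width ψ
width (φ ⇒' ψ) = width φ ⊔ width ψ
width (∃' φ) = width φ
width (∀' φ) = width φ

-- Enough positions to play s rounds: c = 2 ^ r < n, and room outside the radius-c balls around s points.
budget : ℕ → ℕ
budget s = s * (suc (2 ^ s) + suc (2 ^ s)) + 2 ^ s

budget-suffices : ∀ {m r s n} → m + suc r ≤ s → budget s < n → 2 ^ r < n × m * (suc (2 ^ r) + suc (2 ^ r)) < n
budget-suffices {m} {r} {s} m+r<s budget<n =
  ≤-<-trans (≤-trans 2^r≤2^s (m≤n+m (2 ^ s) _)) budget<n ,
  ≤-<-trans (≤-trans (*-mono-≤ m≤s (+-mono-≤ (s≤s 2^r≤2^s) (s≤s 2^r≤2^s))) (m≤m+n _ (2 ^ s))) budget<n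
  where
    m≤s : m ≤ s
    m≤s = ≤-trans (m≤m+n m (suc r)) m+r<s
    2^r≤2^s : 2 ^ r ≤ 2 ^ s
    2^r≤2^s = ^-monoʳ-≤ 2 (≤-trans (≤-trans (n≤1+n r) (m≤n+m (suc r) m)) m+r<s)

module Indistinguishability (nX nY t s w : ℕ) .{{_ : NonTrivial nX}} .{{_ : NonTrivial nY}}
  (budget<nX : budget s < nX) (budget<nY : budget s < nY) (s≤t : s ≤ t) (3[1+w]≤t : 3 * suc w ≤ t) where
  open Similarity nX nY t
  module Y⇔X = Similarity nY nX t

  back-and-forth : ∀ {m r} {ρ : Fin m → X.Vertex} {σ : Fin m → Y.Vertex} → m + suc r ≤ s → Similar (2 ^ suc r) ρ σ →
                   (∀ x → ∃ λ y → Similar (2 ^ r) (extend ρ x) (extend σ y)) ×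
                   (∀ y → ∃ λ x → Similar (2 ^ r) (extend ρ x) (extend σ y))
  back-and-forth {m} {r} m+r<s sim
    with budget-suffices m+r<s budget<nX | budget-suffices m+r<s budget<nY
  ... | 2^r<nX , roomX | 2^r<nY , roomY =
    forth 2^r<nX 2^r<nY roomY m<t sim ,
    λ y → case Y⇔X.forth 2^r<nY 2^r<nX roomX m<t (Similar-swap sim) y of λ where
      (x , sim′) → x , Similar-swap sim′
    where
      m<t : m < t
      m<t = ≤-trans (≤-trans (m<m+n m (s≤s z≤n)) m+r<s) s≤t

  private
    ⊔-≤ˡ : ∀ {a b c} → a ⊔ b ≤ c → a ≤ c
    ⊔-≤ˡ {a} {b} = m⊔n≤o⇒m≤o a b
    ⊔-≤ʳ : ∀ {a b c} → a ⊔ b ≤ c → b ≤ c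
    ⊔-≤ʳ {a} {b} = m⊔n≤o⇒n≤o a b

  Sat-similar : ∀ {m} (φ : Formula m) {r} → rank φ ≤ r → m + r ≤ s → width φ ≤ w →
                ∀ {ρ σ} → Similar (2 ^ r) ρ σ → Sat X.graph φ ρ ⇔ Sat Y.graph φ σ
  Sat-similar (eq i j) _ _ _ sim = mk⇔ (similar-≡ sim i j) (Y⇔X.similar-≡ (Similar-swap sim) i j)
  Sat-similar (edge i j) {r} _ _ _ sim =
    mk⇔ (similar-Adj (m^n>0 2 r) sim i j) (Y⇔X.similar-Adj (m^n>0 2 r) (Similar-swap sim) i j)
  Sat-similar (dp k ab) _ _ k≤w _ =
    mk⇔ (λ _ → Y.disjointPaths (suc k) _ 3[1+k]≤t) (λ _ → X.disjointPaths (suc k) _ 3[1+k]≤t)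
    where
      3[1+k]≤t : 3 * suc k ≤ t
      3[1+k]≤t = ≤-trans (*-monoʳ-≤ 3 (s≤s k≤w)) 3[1+w]≤t
  Sat-similar (¬' φ) rk ms wd sim = ¬-cong-⇔ (Sat-similar φ rk ms wd sim)
  Sat-similar (φ ∧' ψ) rk ms wd sim =
    Sat-similar φ (⊔-≤ˡ rk) ms (⊔-≤ˡ wd) sim ×-⇔ Sat-similar ψ (⊔-≤ʳ rk) ms (⊔-≤ʳ wd) sim
  Sat-similar (φ ∨' ψ) rk ms wd sim =
    Sat-similar φ (⊔-≤ˡ rk) ms (⊔-≤ˡ wd) sim ⊎-⇔ Sat-similar ψ (⊔-≤ʳ rk) ms (⊔-≤ʳ wd) sim
  Sat-similar (φ ⇒' ψ) rk ms wd sim =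
    →-cong-⇔ (Sat-similar φ (⊔-≤ˡ rk) ms (⊔-≤ˡ wd) sim) (Sat-similar ψ (⊔-≤ʳ rk) ms (⊔-≤ʳ wd) sim)
  Sat-similar (∃' φ) {suc r} (s≤s rk) ms wd sim =
    ∃-⇔-zigzag _ (proj₁ (back-and-forth ms sim)) (proj₂ (back-and-forth ms sim))
               (Sat-similar φ rk (subst (_≤ s) (+-suc _ r) ms) wd)
  Sat-similar (∀' φ) {suc r} (s≤s rk) ms wd sim =
    ∀-⇔-zigzag _ (proj₁ (back-and-forth ms sim)) (proj₂ (back-and-forth ms sim))
               (Sat-similar φ rk (subst (_≤ s) (+-suc _ r) ms) wd)

mainTheorem6 : ¬ (Σ Sentence λ φ → (G : Graph) → (G ⊨ φ) ⇔ Bipartite G)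
mainTheorem6 (φ , defines) =
  odd-blowup-not-bipartite h t (Equivalence.to (defines (Blowup.graph nY (suc t)))
    (Equivalence.to (Sat-similar φ ≤-refl ≤-refl ≤-refl (Similarity.similar-empty nX nY (suc t)))
      (Equivalence.from (defines (Blowup.graph nX (suc t))) (even-blowup-bipartite h (suc t)))))
  where
    s w h nX nY t : ℕ
    s = rank φ
    w = width φ
    h = budget s
    nX = 2 + (h + h)
    nY = 3 + (h + h)
    t = w + 2 * suc w + s      -- so that suc t reduces to 3 * suc w + s
    budget<nX : h < nX
    budget<nX = s≤s (≤-trans (m≤m+n h h) (n≤1+n (h + h)))
    open Indistinguishability nX nY (suc t) s w budget<nX (≤-trans budget<nX (n≤1+n nX))
                              (m≤n+m s (3 * suc w)) (m≤m+n (3 * suc w) s)
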